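{- Let $G=(V,E)$ be a DAG, let $d\ge 1$, and let $C_P=\{M_1,\dots,M_h\}$ be a congruence partition of $G$. Let $\Gamma$ be any $d$-dimensional weak dominance drawing of $G$ in which $C_P$ is compact, and let $t$ be the number of outer-fips of $\Gamma$ with respect to $C_P$. Then $t\ge opt(G/C_P)$, where $opt(G/C_P)$ is the minimum cost of a $d$-dimensional weak dominance drawing of the quotient graph $G/C_P$ with vertex costs $c(v_i)=|M_i|$.
   Context: All paths are directed; $u,v$ are incomparable if there is no path from $u$ to $v$ nor from $v$ to $u$. A $d$-dimensional drawing of a DAG has $d$ dimensions, each assigning distinct coordinates $D(v)$ to the vertices. It is a weak dominance drawing if, whenever there is a path from $u$ to $v$, $D(u)<D(v)$ in every dimension $D$. A fip is a pair $(u,v)$ of incomparable vertices with $D(u)<D(v)$ in every dimension. A (path-based) module of $G$ is a nonempty $M\subseteq V$ such that either $|M|=1$ or, for all $v_1,v_2\in M$ and $u\in V\setminus M$: there is a path from $v_1$ to $u$ iff there is one from $v_2$ to $u$, and there is a path from $u$ to $v_1$ iff there is one from $u$ to $v_2$. A congruence partition is a partition of $V$ into modules. The quotient graph $G/C_P$ is obtained from $G$ by merging the vertices of each module $M_i$ into a single super-vertex $v_i$ (with an edge $v_i\to v_j$, $i\neq j$, iff $G$ has an edge from a vertex of $M_i$ to a vertex of $M_j$). For a DAG $H$ whose vertices have costs $c(\cdot)$, the cost of a fip $(u,v)$ of a weak dominance drawing of $H$ is $c(u)\cdot c(v)$, and the cost of the drawing is the sum of the costs of its fips. A module $M$ is compact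 in $\Gamma$ if in every dimension the coordinates of the vertices of $M$ are consecutive; $C_P$ is compact in $\Gamma$ if each of its modules is. A fip $(u,v)$ of $\Gamma$ is an inner-fip if $u,v$ lie in the same module of $C_P$, and an outer-fip otherwise. -}

module Defs where

open import Data.Nat using (ℕ; _<_; _*_)
open import Data.Fin using (Fin; _≟_)
open import Data.Fin.Properties using ()
open import Data.List using (List; length; filter; map; allFin)
open import Data.Nat.ListAction using (sum)
open import Data.List.Membership.Propositional using (_∈_)
open import Data.List.Relation.Unary.Unique.Propositional using (Unique)
open import Data.Product using (Σ; ∃; _×_; _,_)
open import Relation.Binary.PropositionalEquality using (_≡_; _≢_)
open import Relation.Binary.Construct.Closure.Transitive using (TransClosure)
open import Relation.Nullary using (¬_)
open import Function.Bundles using (_⇔_)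
open import Function.Definitions using (Injective; Surjective)
open import Level using (0ℓ)

Graph : ℕ → Set₁
Graph n = Fin n → Fin n → Set

Path : ∀ {n} → Graph n → Fin n → Fin n → Set
Path E = TransClosure E

IsDAG : ∀ {n} → Graph n → Set
IsDAG E = ∀ v → ¬ Path E v v

Incomparable : ∀ {n} → Graph n → Fin n → Fin n → Set
Incomparable E u v = ¬ Path E u v × ¬ Path E v u

record Drawing (n d : ℕ) : Set where
  field
    coord     : Fin d → Fin n → ℕ
    distinct  : ∀ k → Injective _≡_ _≡_ (coord k)
open Drawing public

WeakDominance : ∀ {n d} → Graph n → Drawing n d → Set
WeakDominance E Γ = ∀ u v → Path E u v → ∀ k → coord Γ k u < coord Γ k v

Fip : ∀ {n d} → Graph n → Drawing n d → Fin n → Fin n → Set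
Fip E Γ u v = Incomparable E u v × (∀ k → coord Γ k u < coord Γ k v)

-- A partition of V = Fin n into h blocks, given by the block map μ;
-- M_i = μ⁻¹(i).  Blocks are nonempty (μ surjective).
IsPartition : ∀ {n h} → (Fin n → Fin h) → Set
IsPartition μ = Surjective _≡_ _≡_ μ

IsCongruencePartition : ∀ {n h} → Graph n → (Fin n → Fin h) → Set
IsCongruencePartition E μ =
  IsPartition μ ×
  (∀ v₁ v₂ u → μ v₁ ≡ μ v₂ → μ u ≢ μ v₁ →
     (Path E v₁ u ⇔ Path E v₂ u) × (Path E u v₁ ⇔ Path E u v₂))

Compact : ∀ {n h d} → (Fin n → Fin h) → Drawing n d → Set
Compact μ Γ = ∀ k a b w → μ a ≡ μ b → μ w ≢ μ a →
  ¬ (coord Γ k a < coord Γ k w × coord Γ k w < coord Γ k b)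

OuterFip : ∀ {n h d} → Graph n → (Fin n → Fin h) → Drawing n d → Fin n → Fin n → Set
OuterFip E μ Γ u v = Fip E Γ u v × μ u ≢ μ v

Quotient : ∀ {n h} → Graph n → (Fin n → Fin h) → Graph h
Quotient E μ i j = i ≢ j × Σ _ λ a → Σ _ λ b → μ a ≡ i × μ b ≡ j × E a b

-- "t is the number of pairs satisfying P": a duplicate-free list enumerating
-- exactly the pairs satisfying P has length t.
IsCount : ∀ {n} → (Fin n → Fin n → Set) → ℕ → Set
IsCount {n} P t = Σ (List (Fin n × Fin n)) λ xs →
  Unique xs × (∀ u v → ((u , v) ∈ xs) ⇔ P u v) × length xs ≡ t

blockSize : ∀ {n h} → (Fin n → Fin h) → Fin h → ℕ
blockSize {n} μ i = length (filter (λ v → μ v ≟ i) (allFin n))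

pairCost : ∀ {h} → (Fin h → ℕ) → Fin h × Fin h → ℕ
pairCost c (u , v) = c u * c v

HasCost : ∀ {h d} → Graph h → (Fin h → ℕ) → Drawing h d → ℕ → Set
HasCost {h} E c Γ s = Σ (List (Fin h × Fin h)) λ xs →
  Unique xs × (∀ u v → ((u , v) ∈ xs) ⇔ Fip E Γ u v) × sum (map (pairCost c) xs) ≡ s

{-# OPTIONS --safe #-}
-- Draw G/C_P by placing every super-vertex v_i where Γ places one representative of M_i.
-- Paths of G/C_P lift to paths between representatives, and paths of G between different
-- modules project to G/C_P, so (v_i, v_j) is a fip exactly when the representatives form an
-- outer-fip.  As modules are compact and their vertices have the same paths to the outside,
-- every pair (a, b) ∈ M_i × M_j is then itself an outer-fip; these |M_i|·|M_j| pairs are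
-- distinct for distinct fips, so the cost of the quotient drawing is at most t.
module Submission where

open import Defs
open import Data.Nat using (ℕ; _≤_; _<_; _+_; _*_; suc; z≤n; s≤s)
open import Data.Nat.Properties using (<-cmp; <-irrefl; module ≤-Reasoning)
open import Data.Fin using (Fin; zero; _≟_)
open import Data.Product using (Σ; _×_; _,_; proj₁; proj₂)
open import Data.Product.Properties using (≡-dec)
open import Data.Sum using (inj₁; inj₂)
open import Data.Empty using (⊥-elim)
open import Data.List
  using (List; []; _∷_; _++_; length; filter; map; allFin; cartesianProduct; concatMap)
open import Data.List.Properties using (length-++; length-map; length-removeAt′)
open import Data.Nat.ListAction using (sum)
open import Data.List.Relation.Unary.Any using (here; there; _─_)
import Data.List.Relation.Unary.All as All
open import Data.List.Relation.Unary.AllPairs using ([]; _∷_)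
open import Data.List.Membership.Propositional using (_∈_)
open import Data.List.Membership.Propositional.Properties
  using (∈-filter⁺; ∈-filter⁻; ∈-allFin; ∈-cartesianProduct⁺; ∈-cartesianProduct⁻; ∈-++⁻)
import Data.List.Membership.DecPropositional as DecMembership
open import Data.List.Relation.Binary.Subset.Propositional using (_⊆_)
open import Data.List.Relation.Unary.Unique.Propositional using (Unique)
import Data.List.Relation.Unary.Unique.Propositional.Properties as Unique
open import Relation.Binary.PropositionalEquality
open import Relation.Binary.Definitions using (tri<; tri≈; tri>)
open import Relation.Nullary using (Dec; yes; no)
open import Function.Base using (_∘′_)
open import Function.Bundles using (_⇔_; mk⇔; Equivalence)
open import Relation.Binary.Construct.Closure.Transitive using ([_]; _∷_) renaming (_++_ to _++⁺_)

∈-─⁺ : ∀ {A : Set} {x y : A} {xs : List A} (x∈xs : x ∈ xs) → y ∈ xs → y ≢ x → y ∈ (xs ─ x∈xs)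
∈-─⁺ (here refl) (here refl) y≢x = ⊥-elim (y≢x refl)
∈-─⁺ (here _)    (there y∈xs) _  = y∈xs
∈-─⁺ (there _)   (here y≡z)   _  = here y≡z
∈-─⁺ (there x∈xs) (there y∈xs) y≢x = there (∈-─⁺ x∈xs y∈xs y≢x)

unique-⊆⇒length-≤ : ∀ {A : Set} {xs ys : List A} → Unique xs → xs ⊆ ys → length xs ≤ length ys
unique-⊆⇒length-≤ {xs = []} _ _ = z≤n
unique-⊆⇒length-≤ {xs = x ∷ xs} {ys} (x∉xs ∷ xs-unique) xs⊆ys =
  subst (suc (length xs) ≤_) (sym (length-removeAt′ ys _))
    (s≤s (unique-⊆⇒length-≤ xs-unique xs⊆ys─x))
  where
  x∈ys : x ∈ ys
  x∈ys = xs⊆ys (here refl)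

  xs⊆ys─x : xs ⊆ (ys ─ x∈ys)
  xs⊆ys─x y∈xs = ∈-─⁺ x∈ys (xs⊆ys (there y∈xs)) (λ y≡x → All.lookup x∉xs y∈xs (sym y≡x))

length-cartesianProduct : ∀ {A B : Set} (xs : List A) (ys : List B) →
  length (cartesianProduct xs ys) ≡ length xs * length ys
length-cartesianProduct [] ys = refl
length-cartesianProduct (x ∷ xs) ys =
  trans (length-++ (map (x ,_) ys))
        (cong₂ _+_ (length-map (x ,_) ys) (length-cartesianProduct xs ys))

module _ {n h : ℕ} (μ : Fin n → Fin h) where

  block : Fin h → List (Fin n)
  block i = filter (λ v → μ v ≟ i) (allFin n)

  blockPairs : Fin h × Fin h → List (Fin n × Fin n)
  blockPairs (i , j) = cartesianProduct (block i) (block j)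

  preimagePairs : List (Fin h × Fin h) → List (Fin n × Fin n)
  preimagePairs = concatMap blockPairs

  length-preimagePairs : ∀ ys → length (preimagePairs ys) ≡ sum (map (pairCost (blockSize μ)) ys)
  length-preimagePairs [] = refl
  length-preimagePairs ((i , j) ∷ ys) =
    trans (length-++ (blockPairs (i , j)))
          (cong₂ _+_ (length-cartesianProduct (block i) (block j)) (length-preimagePairs ys))

  ∈-blockPairs⁻ : ∀ {a b ij} → (a , b) ∈ blockPairs ij → (μ a , μ b) ≡ ij
  ∈-blockPairs⁻ {ij = i , j} ab∈ with a∈ , b∈ ← ∈-cartesianProduct⁻ (block i) (block j) ab∈ =
    cong₂ _,_ (proj₂ (∈-filter⁻ (λ v → μ v ≟ i) {xs = allFin n} a∈))
              (proj₂ (∈-filter⁻ (λ v → μ v ≟ j) {xs = allFin n} b∈))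

  ∈-preimagePairs⁻ : ∀ {a b} ys → (a , b) ∈ preimagePairs ys → (μ a , μ b) ∈ ys
  ∈-preimagePairs⁻ (ij ∷ ys) ab∈ with ∈-++⁻ (blockPairs ij) ab∈
  ... | inj₁ ab∈ij = here (∈-blockPairs⁻ ab∈ij)
  ... | inj₂ ab∈ys = there (∈-preimagePairs⁻ ys ab∈ys)

  blockPairs-unique : ∀ ij → Unique (blockPairs ij)
  blockPairs-unique (i , j) = Unique.cartesianProduct⁺ (block-unique i) (block-unique j)
    where
    block-unique : ∀ i → Unique (block i)
    block-unique i = Unique.filter⁺ (λ v → μ v ≟ i) (Unique.allFin⁺ n)

  preimagePairs-unique : ∀ {ys} → Unique ys → Unique (preimagePairs ys)
  preimagePairs-unique {[]} _ = []
  preimagePairs-unique {ij ∷ ys} (ij∉ys ∷ ys-unique) =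
    Unique.++⁺ (blockPairs-unique ij) (preimagePairs-unique ys-unique)
      λ { {a , b} (ab∈ij , ab∈ys) →
            All.lookup ij∉ys (∈-preimagePairs⁻ ys ab∈ys) (sym (∈-blockPairs⁻ ab∈ij)) }

project-path : ∀ {n h} {E : Graph n} (μ : Fin n → Fin h) {a b} →
  Path E a b → μ a ≢ μ b → Path (Quotient E μ) (μ a) (μ b)
project-path μ {a} {b} [ e ] μa≢μb = [ μa≢μb , a , b , refl , refl , e ]
project-path μ {a} {b} (_∷_ {y = c} e c↝b) μa≢μb with μ a ≟ μ c | μ c ≟ μ b
... | yes μa≡μc | _ = subst (λ z → Path (Quotient _ μ) z (μ b)) (sym μa≡μc)
      (project-path μ c↝b (λ μc≡μb → μa≢μb (trans μa≡μc μc≡μb)))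
... | no μa≢μc | yes μc≡μb = subst (Path (Quotient _ μ) (μ a)) μc≡μb [ μa≢μc , a , c , refl , refl , e ]
... | no μa≢μc | no μc≢μb = (μa≢μc , a , c , refl , refl , e) ∷ project-path μ c↝b μc≢μb

fip⇒≢ : ∀ {n d} {E : Graph n} {Γ : Drawing n d} {u v} → Fin d → Fip E Γ u v → u ≢ v
fip⇒≢ k (_ , u<v) refl = <-irrefl refl (u<v k)

module _ {n h d} {E : Graph n} {μ : Fin n → Fin h}
         (congruence : IsCongruencePartition E μ) (Γ : Drawing n d) where

  rep : Fin h → Fin n
  rep i = proj₁ (proj₁ congruence i)

  μ-rep : ∀ i → μ (rep i) ≡ i
  μ-rep i = proj₂ (proj₁ congruence i) refl

  path-between-modules : ∀ {a b a′ b′} → Path E a b →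
    μ a ≡ μ a′ → μ b ≡ μ b′ → μ a ≢ μ b → Path E a′ b′
  path-between-modules {a} {b} {a′} {b′} a↝b μa≡μa′ μb≡μb′ μa≢μb =
    Equivalence.to (proj₂ (proj₂ congruence b b′ a′ μb≡μb′ (λ μa′≡μb → μa≢μb (trans μa≡μa′ μa′≡μb))))
      (Equivalence.to (proj₁ (proj₂ congruence a a′ b μa≡μa′ (λ μb≡μa → μa≢μb (sym μb≡μa)))) a↝b)

  lift-path : ∀ {i j} → Path (Quotient E μ) i j → Path E (rep i) (rep j)
  lift-path [ e ] = lift-edge e
    where
    lift-edge : ∀ {i j} → Quotient E μ i j → Path E (rep i) (rep j)
    lift-edge {i} {j} (i≢j , a , b , μa≡i , μb≡j , e) =
      path-between-modules [ e ] (trans μa≡i (sym (μ-rep i))) (trans μb≡j (sym (μ-rep j)))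
        (λ μa≡μb → i≢j (trans (sym μa≡i) (trans μa≡μb μb≡j)))
  lift-path (e ∷ p) = lift-path [ e ] ++⁺ lift-path p

  repDrawing : Drawing h d
  repDrawing = record
    { coord    = λ k i → coord Γ k (rep i)
    ; distinct = λ k {i} {j} eq → trans (sym (μ-rep i)) (trans (cong μ (distinct Γ k eq)) (μ-rep j))
    }

  repDrawing-weakDominance : WeakDominance E Γ → WeakDominance (Quotient E μ) repDrawing
  repDrawing-weakDominance wd i j i↝j = wd (rep i) (rep j) (lift-path i↝j)

  outerFip-rep⇒fip : ∀ {i j} → OuterFip E μ Γ (rep i) (rep j) → Fip (Quotient E μ) repDrawing i j
  outerFip-rep⇒fip (((¬i↝j , ¬j↝i) , i<j) , _) = ((¬i↝j ∘′ lift-path) , (¬j↝i ∘′ lift-path)) , i<j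

  fip⇒outerFip-rep : Fin d → ∀ {i j} →
    Fip (Quotient E μ) repDrawing i j → OuterFip E μ Γ (rep i) (rep j)
  fip⇒outerFip-rep k {i} {j} fip@((¬i↝j , ¬j↝i) , i<j) =
    (((λ p → ¬i↝j (subst₂ (Path (Quotient E μ)) (μ-rep i) (μ-rep j) (project-path μ p μi≢μj)))
    , (λ p → ¬j↝i (subst₂ (Path (Quotient E μ)) (μ-rep j) (μ-rep i) (project-path μ p (μi≢μj ∘′ sym)))))
    , i<j) , μi≢μj
    where
    μi≢μj : μ (rep i) ≢ μ (rep j)
    μi≢μj μi≡μj = fip⇒≢ {Γ = repDrawing} k fip (trans (sym (μ-rep i)) (trans μi≡μj (μ-rep j)))

  -- If b preceded a, then a′ would lie strictly between b and b′, or b strictly between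
  -- a′ and a, contradicting compactness.
  compact-order : Compact μ Γ → ∀ k {a b a′ b′} → μ a ≡ μ a′ → μ b ≡ μ b′ → μ a ≢ μ b →
    coord Γ k a′ < coord Γ k b′ → coord Γ k a < coord Γ k b
  compact-order compact k {a} {b} {a′} {b′} μa≡μa′ μb≡μb′ μa≢μb a′<b′
    with <-cmp (coord Γ k a) (coord Γ k b)
  ... | tri< a<b _ _ = a<b
  ... | tri≈ _ a≡b _ = ⊥-elim (μa≢μb (cong μ (distinct Γ k a≡b)))
  ... | tri> _ _ b<a with <-cmp (coord Γ k b) (coord Γ k a′)
  ...   | tri< b<a′ _ _ =
            ⊥-elim (compact k b b′ a′ μb≡μb′ (λ μa′≡μb → μa≢μb (trans μa≡μa′ μa′≡μb)) (b<a′ , a′<b′))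
  ...   | tri≈ _ b≡a′ _ = ⊥-elim (μa≢μb (trans μa≡μa′ (sym (cong μ (distinct Γ k b≡a′)))))
  ...   | tri> _ _ a′<b =
            ⊥-elim (compact k a′ a b (sym μa≡μa′) (λ μb≡μa′ → μa≢μb (trans μa≡μa′ (sym μb≡μa′))) (a′<b , b<a))

  outerFip-between-modules : Compact μ Γ → ∀ {a b a′ b′} → OuterFip E μ Γ a′ b′ →
    μ a ≡ μ a′ → μ b ≡ μ b′ → OuterFip E μ Γ a b
  outerFip-between-modules compact (((¬a′↝b′ , ¬b′↝a′) , a′<b′) , μa′≢μb′) μa≡μa′ μb≡μb′ =
    (((λ a↝b → ¬a′↝b′ (path-between-modules a↝b μa≡μa′ μb≡μb′ μa≢μb))
    , (λ b↝a → ¬b′↝a′ (path-between-modules b↝a μb≡μb′ μa≡μa′ (μa≢μb ∘′ sym))))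
    , (λ k → compact-order compact k μa≡μa′ μb≡μb′ μa≢μb (a′<b′ k))) , μa≢μb
    where
    μa≢μb : μ _ ≢ μ _
    μa≢μb μa≡μb = μa′≢μb′ (trans (sym μa≡μa′) (trans μa≡μb μb≡μb′))

  repDrawing-cost-≤-outerFips : Fin d → Compact μ Γ → ∀ {t} → IsCount (OuterFip E μ Γ) t →
    Σ ℕ λ c → HasCost (Quotient E μ) (blockSize μ) repDrawing c × c ≤ t
  repDrawing-cost-≤-outerFips k compact (xs , xs-unique , xs-spec , refl) =
    sum (map (pairCost (blockSize μ)) ys) , (ys , ys-unique , ys-spec , refl) , cost≤t
    where
    open DecMembership (≡-dec _≟_ _≟_) using (_∈?_)

    repPair∈?xs : (ij : Fin h × Fin h) → Dec ((rep (proj₁ ij) , rep (proj₂ ij)) ∈ xs)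
    repPair∈?xs (i , j) = (rep i , rep j) ∈? xs

    ys : List (Fin h × Fin h)
    ys = filter repPair∈?xs (cartesianProduct (allFin h) (allFin h))

    ys-unique : Unique ys
    ys-unique = Unique.filter⁺ repPair∈?xs
      (Unique.cartesianProduct⁺ (Unique.allFin⁺ h) (Unique.allFin⁺ h))

    ∈ys⇒outerFip : ∀ {i j} → (i , j) ∈ ys → OuterFip E μ Γ (rep i) (rep j)
    ∈ys⇒outerFip {i} {j} ij∈ys =
      Equivalence.to (xs-spec (rep i) (rep j))
        (proj₂ (∈-filter⁻ repPair∈?xs {xs = cartesianProduct (allFin h) (allFin h)} ij∈ys))

    ys-spec : ∀ i j → ((i , j) ∈ ys) ⇔ Fip (Quotient E μ) repDrawing i j
    ys-spec i j = mk⇔ (outerFip-rep⇒fip ∘′ ∈ys⇒outerFip) λ fip →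
      ∈-filter⁺ repPair∈?xs (∈-cartesianProduct⁺ (∈-allFin i) (∈-allFin j))
        (Equivalence.from (xs-spec (rep i) (rep j)) (fip⇒outerFip-rep k fip))

    preimage⊆xs : preimagePairs μ ys ⊆ xs
    preimage⊆xs {a , b} ab∈ = Equivalence.from (xs-spec a b)
      (outerFip-between-modules compact (∈ys⇒outerFip (∈-preimagePairs⁻ μ ys ab∈))
        (sym (μ-rep (μ a))) (sym (μ-rep (μ b))))

    cost≤t : sum (map (pairCost (blockSize μ)) ys) ≤ length xs
    cost≤t = begin
      sum (map (pairCost (blockSize μ)) ys) ≡⟨ length-preimagePairs μ ys ⟨
      length (preimagePairs μ ys)
        ≤⟨ unique-⊆⇒length-≤ (preimagePairs-unique μ ys-unique) preimage⊆xs ⟩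
      length xs                             ∎
      where open ≤-Reasoning

lemma2 : ∀ {n h : ℕ} (E : Graph n) → IsDAG E → (d : ℕ) → 1 ≤ d →
    (μ : Fin n → Fin h) → IsCongruencePartition E μ →
    (Γ : Drawing n d) → WeakDominance E Γ → Compact μ Γ →
    (t : ℕ) → IsCount (OuterFip E μ Γ) t →
    Σ (Drawing h d) λ Γ' → Σ ℕ λ c →
      WeakDominance (Quotient E μ) Γ' × HasCost (Quotient E μ) (blockSize μ) Γ' c × c ≤ t
lemma2 E _ (suc d) _ μ congruence Γ wd compact t count =
  let c , cost , c≤t = repDrawing-cost-≤-outerFips congruence Γ zero compact count
  in repDrawing congruence Γ , c , repDrawing-weakDominance congruence Γ wd , cost , c≤t
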